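{- In a bay with $C$ columns, for any configuration $B$ with at most $C$ containers, $S_0(B) = z_{opt}(B) = z_H(B)$.
   Context: A bay has $C$ columns and $P$ tiers with $C \ge P \ge 3$; each column is a stack of at most $P$ containers. Containers have distinct labels giving retrieval order; $N$ denotes the largest label. The target is the smallest label present; a retrieval removes it when topmost. In the restricted CRP, a relocation is allowed only when the target is not topmost, and moves the topmost container of the target's column to the top of another column with fewer than $P$ containers. $z_{opt}(B)$ is the minimum number of relocations needed to retrieve all containers in increasing label order. A container is blocking if it lies above a smaller label in its column; $S_0(B)$ is the number of blocking containers. For a column $c_i$, $\min(c_i)$ is its smallest label, and $N+1$ if empty. Heuristic H: while the bay is nonempty, if the target is topmost retrieve it; otherwise let $c$ be its column and $r$ the topmost container of $c$; among columns $c_i \neq c$ with fewer than $P$ containers, if some has $\min(c_i) > r$, move $r$ to such a column minimizing $\min(c_i)$, else move $r$ to a column maximizing $\min(c_i)$ (ties broken arbitrarily). $z_H(B)$ is the number of relocations performed by H. -}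

module Defs where

open import Data.Nat using (ℕ; zero; suc; _+_; _≤_; _<_; _⊓_; _⊔_; _<?_)
open import Data.List as L using (List; []; _∷_; length; map; foldr)
open import Data.Nat.ListAction using (sum)
open import Data.Bool.ListAction using (any)
open import Data.List.Relation.Unary.Unique.Propositional using (Unique)
open import Data.List.Membership.Propositional using (_∈_)
open import Data.Vec as V using (Vec; lookup; toList; _[_]≔_)
open import Data.Fin using (Fin)
open import Data.Product using (Σ; _×_)
open import Relation.Binary.PropositionalEquality using (_≡_; _≢_)
open import Relation.Nullary.Decidable using (⌊_⌋)
open import Data.Bool using (if_then_else_)

-- A bay with C columns: each column is a stack, written as a list whose
-- head is the topmost container.  Containers are labelled by naturals.
Bay : ℕ → Set
Bay C = Vec (List ℕ) C

labels : ∀ {C} → Bay C → List ℕ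
labels B = L.concat (toList B)

Valid : ∀ {C} → ℕ → Bay C → Set
Valid P B = (∀ i → length (lookup B i) ≤ P) × Unique (labels B)

EmptyBay : ∀ {C} → Bay C → Set
EmptyBay B = ∀ i → lookup B i ≡ []

IsTarget : ∀ {C} → Bay C → ℕ → Set
IsTarget B t = t ∈ labels B × (∀ x → x ∈ labels B → t ≤ x)

blockingCol : List ℕ → ℕ
blockingCol [] = 0
blockingCol (x ∷ rest) =
  (if any (λ y → ⌊ y <? x ⌋) rest then 1 else 0) + blockingCol rest

S0 : ∀ {C} → Bay C → ℕ
S0 B = sum (map blockingCol (toList B))

data Step {C : ℕ} (P : ℕ) : Bay C → Bay C → ℕ → Set where
  retrieve : ∀ (B : Bay C) (i : Fin C) (t : ℕ) (rest : List ℕ) →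
    lookup B i ≡ t ∷ rest → IsTarget B t →
    Step P B (B [ i ]≔ rest) 0
  relocate : ∀ (B : Bay C) (i j : Fin C) (t r : ℕ) (rest : List ℕ) →
    lookup B i ≡ r ∷ rest → t ∈ rest → IsTarget B t →
    i ≢ j → length (lookup B j) < P →
    Step P B ((B [ i ]≔ rest) [ j ]≔ (r ∷ lookup B j)) 1

data Solves {C : ℕ} (P : ℕ) : Bay C → ℕ → Set where
  done : ∀ B → EmptyBay B → Solves P B 0
  step : ∀ {B B' k n} → Step P B B' k → Solves P B' n → Solves P B (k + n)

maxLabel : ∀ {C} → Bay C → ℕ
maxLabel B = foldr _⊔_ 0 (labels B)

minCol : ℕ → List ℕ → ℕ
minCol N c = foldr _⊓_ (suc N) c

Cand : ∀ {C} → ℕ → Bay C → Fin C → Fin C → Set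
Cand P B i j = i ≢ j × length (lookup B j) < P

-- one step of heuristic H (ties broken arbitrarily: any tied choice allowed)
data HStep {C : ℕ} (P : ℕ) : Bay C → Bay C → ℕ → Set where
  retrieve : ∀ (B : Bay C) (i : Fin C) (t : ℕ) (rest : List ℕ) →
    lookup B i ≡ t ∷ rest → IsTarget B t →
    HStep P B (B [ i ]≔ rest) 0
  relocate-above : ∀ (B : Bay C) (i j : Fin C) (t r : ℕ) (rest : List ℕ) →
    lookup B i ≡ r ∷ rest → t ∈ rest → IsTarget B t →
    Cand P B i j →
    r < minCol (maxLabel B) (lookup B j) →
    (∀ j' → Cand P B i j' → r < minCol (maxLabel B) (lookup B j') →
       minCol (maxLabel B) (lookup B j) ≤ minCol (maxLabel B) (lookup B j')) →
    HStep P B ((B [ i ]≔ rest) [ j ]≔ (r ∷ lookup B j)) 1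
  relocate-max : ∀ (B : Bay C) (i j : Fin C) (t r : ℕ) (rest : List ℕ) →
    lookup B i ≡ r ∷ rest → t ∈ rest → IsTarget B t →
    Cand P B i j →
    (∀ j' → Cand P B i j' → minCol (maxLabel B) (lookup B j') ≤ r) →
    (∀ j' → Cand P B i j' →
       minCol (maxLabel B) (lookup B j') ≤ minCol (maxLabel B) (lookup B j)) →
    HStep P B ((B [ i ]≔ rest) [ j ]≔ (r ∷ lookup B j)) 1

data HRun {C : ℕ} (P : ℕ) : Bay C → ℕ → Set where
  done : ∀ B → EmptyBay B → HRun P B 0
  step : ∀ {B B' k n} → HStep P B B' k → HRun P B' n → HRun P B (k + n)

-- B' is reached from B by one step of H (reversed, for use with Acc)
HNext : ∀ {C} → ℕ → Bay C → Bay C → Set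
HNext P B' B = Σ ℕ (HStep P B B')

-- Whether a container blocks depends only on the containers below it.  So a retrieval of the
-- target leaves S₀ unchanged and a relocation changes the status of the moved container only:
-- S₀ drops by at most one per relocation, which makes it a lower bound.  Conversely, with at most
-- C containers a forced relocation means the target's column holds two or more of them, so some
-- other column is empty, and H always finds a column whose minimum exceeds the moved container r.
-- Lying above the target, r was blocking, and at its destination it does not block; so every
-- relocation of H lowers S₀ by exactly one.  The number of containers plus S₀ decreases at every
-- step of H, which gives termination.
module Submission where

open import Defs
open import Data.Nat using (ℕ; zero; suc; _+_; _≤_; _<_; _⊔_; _<?_; z≤n; s≤s)
open import Data.Nat.Properties
open import Data.Nat.Induction using (<-wellFounded)
open import Data.Nat.ListAction using (sum)
open import Data.Bool.ListAction using (any)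
open import Data.Bool using (true; false)
open import Data.Bool.Properties using (T-≡)
open import Data.Fin using (Fin; zero; suc)
import Data.Fin.Properties as Fin
open import Data.List as List using (List; []; _∷_; length; foldr; _++_; filter; allFin)
open import Data.List.Properties using (length-++; ++-conicalˡ; ++-conicalʳ)
open import Data.List.Extrema.Nat
  using (argmin; argmin-sel; argmin-all; f[argmin]≤f[xs]; min; min≤⊤; min≤xs)
open import Data.List.Relation.Unary.All as All using (All; []; _∷_)
open import Data.List.Relation.Unary.All.Properties using (++⁻ˡ; all-filter; All¬⇒¬Any)
open import Data.List.Relation.Unary.Any as Any using (here; there)
open import Data.List.Relation.Unary.Any.Properties using (any⁺; any⁻)
open import Data.List.Relation.Unary.AllPairs using ([]; _∷_)
open import Data.List.Relation.Unary.Unique.Propositional using (Unique)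
open import Data.List.Membership.Propositional using (_∈_)
open import Data.List.Membership.Propositional.Properties
  using (∈-concat⁺′; ∈-++⁻; ∈-filter⁺; ∈-allFin)
open import Data.Vec using ([]; _∷_; lookup; toList; _[_]≔_)
open import Data.Vec.Properties using (lookup∘update; lookup∘update′)
open import Data.Vec.Membership.Propositional.Properties using (∈-lookup; ∈-toList⁺)
open import Data.Product using (Σ; ∃-syntax; _×_; _,_)
open import Data.Sum using (inj₁; inj₂; [_,_]′)
open import Function using (_∘_; Equivalence)
open import Induction.WellFounded using (Acc; acc)
open import Relation.Nullary using (yes; no; ¬?; _×-dec_; contradiction)
open import Relation.Nullary.Decidable using (⌊_⌋; fromWitness; toWitness)
open import Relation.Unary using (Pred; Decidable)
open import Relation.Binary.PropositionalEquality
open import Algebra.Properties.CommutativeSemigroup +-commutativeSemigroup using (x∙yz≈y∙xz)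

∃-minimum : ∀ {x} xs → x ∈ xs → ∃[ t ] t ∈ xs × All (t ≤_) xs
∃-minimum (a ∷ as) _ =
  min a as , [ here , there ]′ (argmin-sel (λ y → y) a as) , min≤⊤ a as ∷ min≤xs a as

∃-argmin : ∀ {n ℓ} {Q : Pred (Fin n) ℓ} → Decidable Q → (f : Fin n → ℕ) →
  ∀ {j₀} → Q j₀ → ∃[ j ] Q j × (∀ j' → Q j' → f j ≤ f j')
∃-argmin {n} Q? f {j₀} q₀ =
  argmin f j₀ candidates ,
  argmin-all f q₀ (all-filter Q? (allFin n)) ,
  λ j' q' → All.lookup (f[argmin]≤f[xs] j₀ candidates) (∈-filter⁺ Q? (∈-allFin j') q')
  where
  candidates = filter Q? (allFin n)

≤-foldr-⊔ : ∀ {x} xs → x ∈ xs → x ≤ foldr _⊔_ 0 xs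
≤-foldr-⊔ (a ∷ as) (here refl) = m≤m⊔n a _
≤-foldr-⊔ (a ∷ as) (there x∈as) = ≤-trans (≤-foldr-⊔ as x∈as) (m≤n⊔m a _)

<minCol⇒All : ∀ {N r} c → r < minCol N c → All (r <_) c
<minCol⇒All [] _ = []
<minCol⇒All (a ∷ c) r<min = m<n⊓o⇒m<n a _ r<min ∷ <minCol⇒All c (m<n⊓o⇒m<o a _ r<min)

sumCols : ∀ {C} → (List ℕ → ℕ) → Bay C → ℕ
sumCols f B = sum (List.map f (toList B))

module _ (f : List ℕ → ℕ) where

  sumCols-update-shrink : ∀ {n} (B : Bay n) i {x k} →
    f (lookup B i) ≡ k + f x → sumCols f B ≡ k + sumCols f (B [ i ]≔ x)
  sumCols-update-shrink (c ∷ B) zero {x} {k} e =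
    trans (cong (_+ sumCols f B) e) (+-assoc k (f x) _)
  sumCols-update-shrink (c ∷ B) (suc i) {k = k} e =
    trans (cong (f c +_) (sumCols-update-shrink B i e)) (x∙yz≈y∙xz (f c) k _)

  sumCols-update-shrink-≤ : ∀ {n} (B : Bay n) i {x k} →
    f (lookup B i) ≤ k + f x → sumCols f B ≤ k + sumCols f (B [ i ]≔ x)
  sumCols-update-shrink-≤ (c ∷ B) zero {x} {k} le =
    ≤-trans (+-monoˡ-≤ (sumCols f B) le) (≤-reflexive (+-assoc k (f x) _))
  sumCols-update-shrink-≤ (c ∷ B) (suc i) {k = k} le =
    ≤-trans (+-monoʳ-≤ (f c) (sumCols-update-shrink-≤ B i le))
            (≤-reflexive (x∙yz≈y∙xz (f c) k _))

  sumCols-update-grow : ∀ {n} (B : Bay n) i {x k} →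
    f x ≡ k + f (lookup B i) → sumCols f (B [ i ]≔ x) ≡ k + sumCols f B
  sumCols-update-grow (c ∷ B) zero {k = k} e =
    trans (cong (_+ sumCols f B) e) (+-assoc k (f c) _)
  sumCols-update-grow (c ∷ B) (suc i) {k = k} e =
    trans (cong (f c +_) (sumCols-update-grow B i e)) (x∙yz≈y∙xz (f c) k _)

  sumCols-empty : f [] ≡ 0 → ∀ {n} (B : Bay n) → EmptyBay B → sumCols f B ≡ 0
  sumCols-empty f[]≡0 [] _ = refl
  sumCols-empty f[]≡0 (c ∷ B) empty rewrite empty zero | f[]≡0 =
    sumCols-empty f[]≡0 B (empty ∘ suc)

  module _ {n} (B : Bay n) {i j r rest} (top : lookup B i ≡ r ∷ rest) (i≢j : i ≢ j) where

    private
      lookup-lifted : lookup (B [ i ]≔ rest) j ≡ lookup B j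
      lookup-lifted = lookup∘update′ (i≢j ∘ sym) B rest

    sumCols-relocate-≤ : ∀ {a} →
      f (r ∷ rest) ≤ a + f rest → f (lookup B j) ≤ f (r ∷ lookup B j) →
      sumCols f B ≤ a + sumCols f ((B [ i ]≔ rest) [ j ]≔ (r ∷ lookup B j))
    sumCols-relocate-≤ {a} popped pushed = ≤-trans
      (sumCols-update-shrink-≤ B i (subst (λ c → f c ≤ a + f rest) (sym top) popped))
      (+-monoʳ-≤ a (sumCols-update-shrink-≤ (B [ i ]≔ rest) j
        (subst (λ c → f c ≤ f (r ∷ lookup B j)) (sym lookup-lifted) pushed)))

    sumCols-relocate-≡ : ∀ {a b} →
      f (r ∷ rest) ≡ a + f rest → f (r ∷ lookup B j) ≡ b + f (lookup B j) →
      b + sumCols f B ≡ a + sumCols f ((B [ i ]≔ rest) [ j ]≔ (r ∷ lookup B j))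
    sumCols-relocate-≡ {a} {b} popped pushed = begin
      b + sumCols f B                                ≡⟨ cong (b +_) (sumCols-update-shrink B i popped′) ⟩
      b + (a + sumCols f lifted)                     ≡⟨ x∙yz≈y∙xz b a _ ⟩
      a + (b + sumCols f lifted)                     ≡⟨ cong (a +_) (sumCols-update-grow lifted j pushed′) ⟨
      a + sumCols f (lifted [ j ]≔ (r ∷ lookup B j)) ∎
      where
      open ≡-Reasoning
      lifted = B [ i ]≔ rest
      popped′ = trans (cong f top) popped
      pushed′ = trans pushed (cong (λ c → b + f c) (sym lookup-lifted))

length-labels : ∀ {C} (B : Bay C) → length (labels B) ≡ sumCols length B
length-labels [] = refl
length-labels (c ∷ B) = trans (length-++ c) (cong (length c +_) (length-labels B))

∈-labels⁺ : ∀ {C} (B : Bay C) i {c x} → lookup B i ≡ c → x ∈ c → x ∈ labels B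
∈-labels⁺ B i refl x∈c = ∈-concat⁺′ x∈c (∈-toList⁺ (∈-lookup i B))

∈-labels⁻ : ∀ {C} (B : Bay C) {x} → x ∈ labels B → ∃[ i ] x ∈ lookup B i
∈-labels⁻ (c ∷ B) x∈ with ∈-++⁻ c x∈
... | inj₁ x∈c = zero , x∈c
... | inj₂ x∈B = let i , x∈i = ∈-labels⁻ B x∈B in suc i , x∈i

labels≡[]⇒empty : ∀ {C} (B : Bay C) → labels B ≡ [] → EmptyBay B
labels≡[]⇒empty (c ∷ B) eq zero = ++-conicalˡ c _ eq
labels≡[]⇒empty (c ∷ B) eq (suc i) = labels≡[]⇒empty B (++-conicalʳ c _ eq) i

Unique-columns : ∀ {C} (B : Bay C) → Unique (labels B) → ∀ i → Unique (lookup B i)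
Unique-columns (c ∷ B) u zero = prefix c u
  where
  prefix : ∀ xs {ys} → Unique (xs ++ ys) → Unique xs
  prefix [] _ = []
  prefix (x ∷ xs) (x∉ ∷ u) = ++⁻ˡ xs x∉ ∷ prefix xs u
Unique-columns (c ∷ B) u (suc i) = Unique-columns B (suffix c u) i
  where
  suffix : ∀ xs {ys} → Unique (xs ++ ys) → Unique ys
  suffix [] u = u
  suffix (x ∷ xs) (_ ∷ u) = suffix xs u

blockingCol-unblocked : ∀ {x} c → All (x ≤_) c → blockingCol (x ∷ c) ≡ blockingCol c
blockingCol-unblocked {x} c x≤c with any (λ y → ⌊ y <? x ⌋) c in eq
... | false = refl
... | true = contradiction (any⁻ _ c (Equivalence.from T-≡ eq))
                (All¬⇒¬Any (All.map (λ x≤y y<x → <⇒≱ (toWitness y<x) x≤y) x≤c))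

blockingCol-blocked : ∀ {x y} c → y ∈ c → y < x → blockingCol (x ∷ c) ≡ suc (blockingCol c)
blockingCol-blocked {x} c y∈c y<x
  rewrite Equivalence.to T-≡ (any⁺ (λ z → ⌊ z <? x ⌋) (Any.map (λ { refl → fromWitness y<x }) y∈c))
  = refl

blockingCol-∷-≤ : ∀ x c → blockingCol (x ∷ c) ≤ suc (blockingCol c)
blockingCol-∷-≤ x c with any (λ y → ⌊ y <? x ⌋) c
... | true = ≤-refl
... | false = n≤1+n _

target≤rest : ∀ {C} (B : Bay C) i {t rest} → lookup B i ≡ t ∷ rest → IsTarget B t →
  All (t ≤_) rest
target≤rest B i top (_ , t≤) = All.tabulate λ y∈rest → t≤ _ (∈-labels⁺ B i top (there y∈rest))

S0-retrieve : ∀ {C} (B : Bay C) i {t rest} → lookup B i ≡ t ∷ rest → IsTarget B t →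
  S0 B ≡ S0 (B [ i ]≔ rest)
S0-retrieve B i {rest = rest} top target = sumCols-update-shrink blockingCol B i
  (trans (cong blockingCol top) (blockingCol-unblocked rest (target≤rest B i top target)))

S0-step-≤ : ∀ {C P} {B B' : Bay C} {k} → Step P B B' k → S0 B ≤ k + S0 B'
S0-step-≤ (retrieve B i t rest top target) = ≤-reflexive (S0-retrieve B i top target)
S0-step-≤ (relocate B i j t r rest top _ _ i≢j _) =
  sumCols-relocate-≤ blockingCol B top i≢j (blockingCol-∷-≤ r rest) (m≤n+m _ _)

S0-solves-≤ : ∀ {C P} {B : Bay C} {n} → Solves P B n → S0 B ≤ n
S0-solves-≤ (done B empty) = ≤-reflexive (sumCols-empty blockingCol refl B empty)
S0-solves-≤ (step {k = k} s sol) = ≤-trans (S0-step-≤ s) (+-monoʳ-≤ k (S0-solves-≤ sol))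

emptyColumn : ∀ {n} (B : Bay n) → sumCols length B < n → ∃[ j ] lookup B j ≡ []
emptyColumn ([] ∷ B) _ = zero , refl
emptyColumn ((_ ∷ c) ∷ B) (s≤s few) =
  let j , empty = emptyColumn B (≤-trans (s≤s (m≤n+m _ (length c))) few) in suc j , empty

spareEmptyColumn : ∀ {n} (B : Bay n) i → sumCols length B ≤ n → 2 ≤ length (lookup B i) →
  ∃[ j ] i ≢ j × lookup B j ≡ []
spareEmptyColumn (c ∷ B) zero few tall =
  let j , empty = emptyColumn B (≤-pred (≤-trans (+-monoˡ-≤ (sumCols length B) tall) few))
  in suc j , (λ ()) , empty
spareEmptyColumn ([] ∷ B) (suc i) _ _ = zero , (λ ()) , refl
spareEmptyColumn ((_ ∷ c) ∷ B) (suc i) few tall =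
  let j , i≢j , empty = spareEmptyColumn B i (≤-trans (m≤n+m _ (length c)) (≤-pred few)) tall
  in suc j , i≢j ∘ Fin.suc-injective , empty

∀-columns-update : ∀ {n} (Q : List ℕ → Set) (B : Bay n) → (∀ k → Q (lookup B k)) →
  ∀ i {x} → Q x → ∀ k → Q (lookup (B [ i ]≔ x) k)
∀-columns-update Q B all i {x} qx k with k Fin.≟ i
... | yes refl = subst Q (sym (lookup∘update k B x)) qx
... | no k≢i = subst Q (sym (lookup∘update′ k≢i B x)) (all k)

-- Distinctness is only needed within columns, and in that form it is easy to preserve.
record SparseBay {C} (P : ℕ) (B : Bay C) : Set where
  field
    heights  : ∀ k → length (lookup B k) ≤ P
    distinct : ∀ k → Unique (lookup B k)
    few      : sumCols length B ≤ C

  popped-height : ∀ {i r rest} → lookup B i ≡ r ∷ rest → length rest ≤ P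
  popped-height {i} top = ≤-trans (n≤1+n _) (subst (λ c → length c ≤ P) top (heights i))

  popped-distinct : ∀ {i r rest} → lookup B i ≡ r ∷ rest → Unique rest
  popped-distinct {i} top with subst Unique top (distinct i)
  ... | _ ∷ distinct-rest = distinct-rest

  top≢below : ∀ {i r rest y} → lookup B i ≡ r ∷ rest → y ∈ rest → r ≢ y
  top≢below {i} top y∈rest with subst Unique top (distinct i)
  ... | r∉rest ∷ _ = All.lookup r∉rest y∈rest

potential : ∀ {C} → Bay C → ℕ
potential B = sumCols length B + S0 B

data GoodStep {C} (P : ℕ) (B : Bay C) : Bay C → ℕ → Set where
  retrieve : ∀ {i t rest} → lookup B i ≡ t ∷ rest → IsTarget B t →
    GoodStep P B (B [ i ]≔ rest) 0
  relocate : ∀ {i j r t rest} → lookup B i ≡ r ∷ rest → t ∈ rest → t < r →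
    i ≢ j → length (lookup B j) < P → All (r <_) (lookup B j) →
    GoodStep P B ((B [ i ]≔ rest) [ j ]≔ (r ∷ lookup B j)) 1

module _ {C P : ℕ} {B : Bay C} where

  private
    Fits : List ℕ → Set
    Fits c = length c ≤ P

  S0-goodStep : ∀ {B' k} → GoodStep P B B' k → S0 B ≡ k + S0 B'
  S0-goodStep (retrieve top target) = S0-retrieve B _ top target
  S0-goodStep (relocate {rest = rest} top t∈rest t<r i≢j _ r<col) =
    sumCols-relocate-≡ blockingCol B top i≢j (blockingCol-blocked rest t∈rest t<r)
      (blockingCol-unblocked _ (All.map <⇒≤ r<col))

  size-goodStep : ∀ {B' k} → GoodStep P B B' k → k + sumCols length B ≡ 1 + sumCols length B'
  size-goodStep (retrieve top _) = sumCols-update-shrink length B _ (cong length top)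
  size-goodStep (relocate top _ _ i≢j _ _) = sumCols-relocate-≡ length B top i≢j refl refl

  potential-goodStep : ∀ {B' k} → GoodStep P B B' k → potential B' < potential B
  potential-goodStep {B'} {k} s = ≤-reflexive (begin
    suc (sumCols length B' + S0 B')      ≡⟨ cong (_+ S0 B') (size-goodStep s) ⟨
    (k + sumCols length B) + S0 B'       ≡⟨ +-assoc k _ _ ⟩
    k + (sumCols length B + S0 B')       ≡⟨ x∙yz≈y∙xz k (sumCols length B) _ ⟩
    sumCols length B + (k + S0 B')       ≡⟨ cong (sumCols length B +_) (S0-goodStep s) ⟨
    potential B                          ∎)
    where open ≡-Reasoning

  sparse-goodStep : ∀ {B' k} → SparseBay P B → GoodStep P B B' k → SparseBay P B'
  sparse-goodStep sparse s@(retrieve {i} {rest = rest} top _) = record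
    { heights  = ∀-columns-update Fits B heights i (popped-height top)
    ; distinct = ∀-columns-update Unique B distinct i (popped-distinct top)
    ; few      = ≤-trans (n≤1+n _) (≤-trans (≤-reflexive (sym (size-goodStep s))) few)
    }
    where open SparseBay sparse
  sparse-goodStep sparse s@(relocate {i} {j} {r} {rest = rest} top _ _ _ room r<col) = record
    { heights  = ∀-columns-update Fits (B [ i ]≔ rest)
                   (∀-columns-update Fits B heights i (popped-height top)) j room
    ; distinct = ∀-columns-update Unique (B [ i ]≔ rest)
                   (∀-columns-update Unique B distinct i (popped-distinct top)) j
                   (All.map <⇒≢ r<col ∷ distinct j)
    ; few      = ≤-trans (≤-reflexive (sym (suc-injective (size-goodStep s)))) few
    }
    where open SparseBay sparse

module _ {C P : ℕ} {B : Bay C} (sparse : SparseBay P B)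
         {i r t rest} (top : lookup B i ≡ r ∷ rest) (t∈rest : t ∈ rest) where
  open SparseBay sparse

  target<top : IsTarget B t → t < r
  target<top (_ , t≤) = ≤∧≢⇒< (t≤ r (∈-labels⁺ B i top (here refl))) (top≢below top t∈rest ∘ sym)

  ∃-candidate-above : 0 < P → ∃[ j ] Cand P B i j × r < minCol (maxLabel B) (lookup B j)
  ∃-candidate-above 0<P =
    let j , i≢j , empty = spareEmptyColumn B i few (subst (λ c → 2 ≤ length c) (sym top) (tall t∈rest))
    in j , subst (λ c → (i ≢ j × length c < P) × r < minCol (maxLabel B) c) (sym empty)
             ((i≢j , 0<P) , s≤s r≤N)
    where
    r≤N : r ≤ maxLabel B
    r≤N = ≤-foldr-⊔ (labels B) (∈-labels⁺ B i top (here refl))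

    tall : ∀ {y ys} → y ∈ ys → 2 ≤ length (r ∷ ys)
    tall {ys = _ ∷ _} _ = s≤s (s≤s z≤n)

module _ {C P : ℕ} (0<P : 0 < P) {B : Bay C} (sparse : SparseBay P B) where

  HStep⇒GoodStep : ∀ {B' k} → HStep P B B' k → GoodStep P B B' k
  HStep⇒GoodStep (retrieve _ _ _ _ top target) = retrieve top target
  HStep⇒GoodStep (relocate-above _ _ _ _ _ _ top t∈rest target (i≢j , room) r<min _) =
    relocate top t∈rest (target<top sparse top t∈rest target) i≢j room (<minCol⇒All _ r<min)
  HStep⇒GoodStep (relocate-max _ _ _ _ _ _ top t∈rest _ _ below _) =
    let j , cand , r<min = ∃-candidate-above sparse top t∈rest 0<P
    in contradiction (below j cand) (<⇒≱ r<min)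

  HStep-exists : ∀ {x} → x ∈ labels B → ∃[ B' ] ∃[ k ] HStep P B B' k
  HStep-exists x∈B =
    let t , t∈B , t≤B = ∃-minimum (labels B) x∈B
        i , t∈col = ∈-labels⁻ B t∈B
    in from-column i (t∈B , λ _ y∈B → All.lookup t≤B y∈B) refl t∈col
    where
    N = maxLabel B

    from-column : ∀ i {t c} → IsTarget B t → lookup B i ≡ c → t ∈ c → ∃[ B' ] ∃[ k ] HStep P B B' k
    from-column i {c = t ∷ rest} target top (here refl) = _ , _ , retrieve B i t rest top target
    from-column i {t} {r ∷ rest} target top (there t∈rest) =
      let j₀ , above₀ = ∃-candidate-above sparse top t∈rest 0<P
          j , (cand , r<min) , minimal = ∃-argmin above? (λ j' → minCol N (lookup B j')) above₀
      in _ , _ , relocate-above B i j t r rest top t∈rest target cand r<min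
                   (λ j' cand′ r<min′ → minimal j' (cand′ , r<min′))
      where
      above? : Decidable (λ j' → Cand P B i j' × r < minCol N (lookup B j'))
      above? j' =
        (¬? (i Fin.≟ j') ×-dec (length (lookup B j') <? P)) ×-dec (r <? minCol N (lookup B j'))

HStep⇒Step : ∀ {C P} {B B' : Bay C} {k} → HStep P B B' k → Step P B B' k
HStep⇒Step (retrieve B i t rest top target) = retrieve B i t rest top target
HStep⇒Step (relocate-above B i j t r rest top t∈rest target (i≢j , room) _ _) =
  relocate B i j t r rest top t∈rest target i≢j room
HStep⇒Step (relocate-max B i j t r rest top t∈rest target (i≢j , room) _ _) =
  relocate B i j t r rest top t∈rest target i≢j room

HRun⇒Solves : ∀ {C P} {B : Bay C} {n} → HRun P B n → Solves P B n
HRun⇒Solves (done B empty) = done B empty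
HRun⇒Solves (step s run) = step (HStep⇒Step s) (HRun⇒Solves run)

module _ {C P : ℕ} (0<P : 0 < P) where

  H-terminates : (B : Bay C) → SparseBay P B → Acc (HNext P) B
  H-terminates B sparse = go sparse (<-wellFounded (potential B))
    where
    go : ∀ {B} → SparseBay P B → Acc _<_ (potential B) → Acc (HNext P) B
    go sparse (acc smaller) = acc λ (_ , s) →
      let good = HStep⇒GoodStep 0<P sparse s
      in go (sparse-goodStep sparse good) (smaller (potential-goodStep good))

  HRun-exists : ∀ {B : Bay C} → SparseBay P B → Acc (HNext P) B → ∃[ n ] HRun P B n
  HRun-exists {B} sparse (acc next) with labels B in eq
  ... | [] = 0 , done B (labels≡[]⇒empty B eq)
  ... | x ∷ _ =
    let _ , k , s = HStep-exists 0<P sparse (subst (x ∈_) (sym eq) (here refl))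
        n , run = HRun-exists (sparse-goodStep sparse (HStep⇒GoodStep 0<P sparse s)) (next (k , s))
    in k + n , step s run

  HRun-S0 : ∀ {B : Bay C} {n} → SparseBay P B → HRun P B n → n ≡ S0 B
  HRun-S0 _ (done B empty) = sym (sumCols-empty blockingCol refl B empty)
  HRun-S0 sparse (step {k = k} s run) =
    let good = HStep⇒GoodStep 0<P sparse s
    in trans (cong (k +_) (HRun-S0 (sparse-goodStep sparse good) run)) (sym (S0-goodStep good))

proposition4 : (C P : ℕ) → 3 ≤ P → P ≤ C → (B : Bay C) →
    Valid P B → length (labels B) ≤ C →
    (Solves P B (S0 B) × (∀ n → Solves P B n → S0 B ≤ n))
    × (Σ ℕ (λ n → HRun P B n) × (∀ n → HRun P B n → n ≡ S0 B) × Acc (HNext P) B)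
proposition4 C P 3≤P _ B (heights , unique) size≤C =
  let n , run = HRun-exists 0<P sparse terminates
  in (subst (Solves P B) (HRun-S0 0<P sparse run) (HRun⇒Solves run) , λ _ → S0-solves-≤)
     , (n , run) , (λ _ → HRun-S0 0<P sparse) , terminates
  where
  0<P : 0 < P
  0<P = ≤-trans (s≤s z≤n) 3≤P
  sparse : SparseBay P B
  sparse = record
    { heights  = heights
    ; distinct = Unique-columns B unique
    ; few      = subst (_≤ C) (length-labels B) size≤C
    }
  terminates : Acc (HNext P) B
  terminates = H-terminates 0<P B sparse
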